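{- Let $\mathcal{A}_+$ be a finite set of positive reals and let $X$ be a finite graph. Call vertices $u,v\in V(X)$ equivalent if $N(u)=N(v)$, where $N(\cdot)$ denotes the set of neighbours in $X$. Let $V'\subseteq V(X)$ contain exactly one vertex from each equivalence class, and let $X'$ be the subgraph of $X$ induced by $V'$. Then $X$ is strictly $\mathcal{A}_+$-embeddable in $\mathbb{R}^1$ if and only if $X'$ is strictly injectively $\mathcal{A}_+$-embeddable in $\mathbb{R}^1$.
   Context: A map $\phi:V(X)\to\mathbb{R}$ is an $\mathcal{A}_+$-embedding of $X$ in $\mathbb{R}^1$ if $|\phi(x)-\phi(y)|\in\mathcal{A}_+$ for every edge $xy$; it is strict if moreover $|\phi(x)-\phi(y)|\notin\mathcal{A}_+$ for every pair of distinct non-adjacent vertices $x,y$; it is injective if $\phi$ is injective. -}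

module Defs where

open import Level using (0ℓ)
open import Data.Nat using (ℕ)
open import Data.Fin using (Fin)
open import Data.Fin.Subset using (Subset; _∈_)
open import Data.Product using (Σ; ∃; _×_; _,_; proj₁)
open import Data.Sum using (_⊎_)
open import Data.List using (List)
import Data.List.Membership.Propositional as LM
open import Relation.Nullary using (¬_)
open import Relation.Binary.PropositionalEquality using (_≡_; _≢_)
open import Relation.Binary.Definitions using (Tri; tri<; tri≈; tri>)
open import Relation.Binary.Structures using (IsStrictTotalOrder)
open import Algebra.Structures using (IsCommutativeRing)
open import Function.Bundles using (_⇔_)

-- The real line ℝ, axiomatised as a Dedekind-complete ordered field
-- (such a structure is unique up to isomorphism, so quantifying over
-- all of them is the same as speaking about ℝ).

record RealField : Set₁ where
  infixl 6 _+_ _-_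
  infixl 7 _*_
  infix 4 _<_ _≤_
  field
    Carrier : Set
    _+_ _*_ : Carrier → Carrier → Carrier
    -_      : Carrier → Carrier
    0# 1#   : Carrier
    _<_     : Carrier → Carrier → Set
    isCommutativeRing : IsCommutativeRing _≡_ _+_ _*_ -_ 0# 1#
    0≢1     : 0# ≢ 1#
    *-inv   : ∀ x → x ≢ 0# → ∃ λ y → x * y ≡ 1#
    isStrictTotalOrder : IsStrictTotalOrder _≡_ _<_
    +-mono-< : ∀ {x y} z → x < y → x + z < y + z
    *-pos    : ∀ {x y} → 0# < x → 0# < y → 0# < x * y

  _≤_ : Carrier → Carrier → Set
  x ≤ y = x < y ⊎ x ≡ y

  field
    sup : (P : Carrier → Set) → ∃ P → (∃ λ b → ∀ x → P x → x ≤ b) →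
          ∃ λ s → (∀ x → P x → x ≤ s) × (∀ b → (∀ x → P x → x ≤ b) → s ≤ b)

  _-_ : Carrier → Carrier → Carrier
  x - y = x + (- y)

  ∣_∣ : Carrier → Carrier
  ∣ x ∣ with IsStrictTotalOrder.compare isStrictTotalOrder x 0#
  ... | tri< _ _ _ = - x
  ... | tri≈ _ _ _ = x
  ... | tri> _ _ _ = x

module _ (R : RealField) where
  open RealField R
  open LM using () renaming (_∈_ to _∈ₗ_; _∉_ to _∉ₗ_)

  IsAEmbedding : {V : Set} (E : V → V → Set) (A : List Carrier) (φ : V → Carrier) → Set
  IsAEmbedding E A φ = ∀ x y → E x y → ∣ φ x - φ y ∣ ∈ₗ A

  IsStrictAEmbedding : {V : Set} (E : V → V → Set) (A : List Carrier) (φ : V → Carrier) → Set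
  IsStrictAEmbedding E A φ =
    IsAEmbedding E A φ × (∀ x y → x ≢ y → ¬ E x y → ∣ φ x - φ y ∣ ∉ₗ A)

  StrictlyEmbeddable : {V : Set} (E : V → V → Set) (A : List Carrier) → Set
  StrictlyEmbeddable {V} E A = Σ (V → Carrier) λ φ → IsStrictAEmbedding E A φ

  StrictlyInjectivelyEmbeddable : {V : Set} (E : V → V → Set) (A : List Carrier) → Set
  StrictlyInjectivelyEmbeddable {V} E A =
    Σ (V → Carrier) λ φ → IsStrictAEmbedding E A φ × (∀ x y → φ x ≡ φ y → x ≡ y)

record Graph (n : ℕ) : Set₁ where
  field
    E       : Fin n → Fin n → Set
    sym     : ∀ {x y} → E x y → E y x
    irrefl  : ∀ {x} → ¬ E x x

module _ {n : ℕ} (X : Graph n) where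
  open Graph X

  SameNbhd : Fin n → Fin n → Set
  SameNbhd u v = ∀ w → E u w ⇔ E v w

  IsTransversal : Subset n → Set
  IsTransversal V' = ∀ u → Σ (Fin n) λ v →
    v ∈ V' × SameNbhd u v × (∀ w → w ∈ V' → SameNbhd u w → w ≡ v)

  InducedV : Subset n → Set
  InducedV V' = Σ (Fin n) λ v → v ∈ V'

  InducedE : (V' : Subset n) → InducedV V' → InducedV V' → Set
  InducedE V' x y = E (proj₁ x) (proj₁ y)

module Submission where

-- Vertices with equal neighbourhoods ("twins") are indistinguishable for a
-- strict A₊-embedding, so one may place them at the same point; conversely
-- a strict embedding must place twins and only twins together, because A₊
-- consists of positive distances and therefore never contains ∣x - x∣ = 0.
--
-- Both directions are instances of one general fact, `pullback-strict`:
-- strict embeddings pull back along maps of vertex sets that preserve and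
-- reflect adjacency.  The forward direction pulls back along the inclusion
-- V' ↪ V(X); the backward one along the map sending each vertex to its
-- representative in V'.  The remaining content is injectivity in the
-- forward direction: vertices placed at the same point have the same
-- neighbourhood (`coincident⇒¬¬sameNbhd`), hence are equal when both lie
-- in the transversal V'.  Adjacency is an arbitrary (undecidable) relation,
-- so that argument runs in the double-negation monad, which is harmless
-- because equality of vertices of Fin n is decidable.

open import Defs
open import Level using (0ℓ)
open import Data.Nat using (ℕ)
open import Data.Fin using (Fin; _≟_)
open import Data.Fin.Properties using (sequence)
open import Data.Fin.Subset using (Subset; _∈_)
open import Data.Vec.Properties.WithK using ([]=-irrelevant)
open import Data.List using (List)
open import Data.List.Relation.Unary.All using (All)
import Data.List.Relation.Unary.All as All
import Data.List.Membership.Propositional as LM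
open import Data.Empty using (⊥-elim)
open import Data.Product using (_,_; proj₁)
open import Function.Base using (_∘_)
open import Function.Bundles using (_⇔_; mk⇔; Equivalence)
open import Function.Construct.Identity using (⇔-id)
open import Function.Construct.Composition using (_⇔-∘_)
open import Effect.Monad using (RawMonad)
open import Relation.Nullary using (¬_; yes; no)
open import Relation.Nullary.Negation using (¬¬-Monad; ¬¬-map)
open import Relation.Nullary.Decidable using (decidable-stable; ¬¬-excluded-middle)
open import Relation.Binary.PropositionalEquality
  using (_≡_; _≢_; refl; sym; trans; cong; subst; module ≡-Reasoning)
open import Relation.Binary.Definitions using (tri<; tri≈; tri>)
open import Relation.Binary.Structures using (IsStrictTotalOrder)
open import Algebra.Structures using (IsCommutativeRing)

open RawMonad (¬¬-Monad {0ℓ}) using (rawApplicative; pure; _>>=_)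

¬¬-intro-→ : {P Q : Set} → (P → ¬ ¬ Q) → ¬ ¬ (P → Q)
¬¬-intro-→ f ¬p→q = ¬p→q (λ p → ⊥-elim (f p (λ q → ¬p→q (λ _ → q))))

module StrictEmbeddings (R : RealField) (A : List (RealField.Carrier R))
                        (positive : All (RealField._<_ R (RealField.0# R)) A) where
  open RealField R
  open IsCommutativeRing isCommutativeRing using (-‿inverseʳ)
  open LM using () renaming (_∈_ to _∈ₗ_; _∉_ to _∉ₗ_)

  ∣0∣≡0 : ∣ 0# ∣ ≡ 0#
  ∣0∣≡0 with IsStrictTotalOrder.compare isStrictTotalOrder 0# 0#
  ... | tri< _ 0≢0 _ = ⊥-elim (0≢0 refl)
  ... | tri≈ _ _ _   = refl
  ... | tri> _ _ _   = refl

  0∉A : 0# ∉ₗ A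
  0∉A 0∈A = IsStrictTotalOrder.irrefl isStrictTotalOrder refl (All.lookup positive 0∈A)

  self-distance∉A : ∀ x → ∣ x - x ∣ ∉ₗ A
  self-distance∉A x = 0∉A ∘ subst (_∈ₗ A) ∣x-x∣≡0
    where
    open ≡-Reasoning
    ∣x-x∣≡0 : ∣ x - x ∣ ≡ 0#
    ∣x-x∣≡0 = begin
      ∣ x - x ∣ ≡⟨ cong ∣_∣ (-‿inverseʳ x) ⟩
      ∣ 0# ∣    ≡⟨ ∣0∣≡0 ⟩
      0#        ∎

  -- Non-adjacent u ≢ w either collapse under ρ (distance 0)
  -- or stay distinct and non-adjacent; as the goal is a negation, this
  -- case split needs no decidability.
  pullback-strict : {V W : Set} {E : V → V → Set} {F : W → W → Set} (ρ : V → W) →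
    (∀ u w → E u w ⇔ F (ρ u) (ρ w)) →
    (ψ : W → Carrier) → IsStrictAEmbedding R F A ψ → IsStrictAEmbedding R E A (ψ ∘ ρ)
  pullback-strict {E = E} ρ full ψ (embedding , strict) = embedding′ , strict′
    where
    embedding′ : IsAEmbedding R E A (ψ ∘ ρ)
    embedding′ u w = embedding (ρ u) (ρ w) ∘ Equivalence.to (full u w)

    strict′ : ∀ u w → u ≢ w → ¬ E u w → ∣ ψ (ρ u) - ψ (ρ w) ∣ ∉ₗ A
    strict′ u w _ ¬uw d = ¬¬-excluded-middle λ where
      (yes ρu≡ρw) → self-distance∉A (ψ (ρ u))
                      (subst (λ z → ∣ ψ (ρ u) - ψ z ∣ ∈ₗ A) (sym ρu≡ρw) d)
      (no ρu≢ρw)  → strict (ρ u) (ρ w) ρu≢ρw (¬uw ∘ Equivalence.from (full u w)) d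

  -- In a strict embedding, a neighbour of x is (up to ¬¬) a neighbour of
  -- any y placed at the same point: the distance φ y ↦ φ w equals the
  -- distance φ x ↦ φ w, which lies in A, and only edges realise such
  -- distances (y = w is impossible as that distance would be 0).
  coincident-adjacency : {V : Set} {E : V → V → Set} {φ : V → Carrier} →
    IsStrictAEmbedding R E A φ → ∀ {x y} → φ x ≡ φ y → ∀ w → E x w → ¬ ¬ E y w
  coincident-adjacency {φ = φ} (embedding , strict) {x} {y} φx≡φy w xw ¬yw =
    ¬¬-excluded-middle λ where
      (yes y≡w) → self-distance∉A (φ y) (subst (λ z → ∣ φ y - φ z ∣ ∈ₗ A) (sym y≡w) d)
      (no y≢w)  → strict y w y≢w ¬yw d
    where
    d : ∣ φ y - φ w ∣ ∈ₗ A
    d = subst (λ z → ∣ z - φ w ∣ ∈ₗ A) φx≡φy (embedding x w xw)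

  coincident⇒¬¬sameNbhd : {V : Set} {E : V → V → Set} {φ : V → Carrier} →
    IsStrictAEmbedding R E A φ → ∀ {x y} → φ x ≡ φ y → ∀ w → ¬ ¬ (E x w ⇔ E y w)
  coincident⇒¬¬sameNbhd strict φx≡φy w = do
    to   ← ¬¬-intro-→ (coincident-adjacency strict φx≡φy w)
    from ← ¬¬-intro-→ (coincident-adjacency strict (sym φx≡φy) w)
    pure (mk⇔ to from)

module Transversal {n : ℕ} (X : Graph n) (V' : Subset n) (T : IsTransversal X V') where
  open Graph X using (E) renaming (sym to E-sym)

  -- Members of the induced subgraph are determined by their vertex,
  -- membership proofs in a subset being unique.
  inducedV-≡ : {a b : InducedV X V'} → proj₁ a ≡ proj₁ b → a ≡ b
  inducedV-≡ {x , x∈V'} {.x , x∈V'′} refl = cong (x ,_) ([]=-irrelevant x∈V' x∈V'′)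

  -- Two members of V' with the same neighbourhood coincide: both equal the
  -- unique representative in V' of the twin class of the first.
  twins-in-V'-coincide : ∀ {x y} → x ∈ V' → y ∈ V' → SameNbhd X x y → x ≡ y
  twins-in-V'-coincide {x} {y} x∈V' y∈V' x~y with T x
  ... | _ , _ , _ , unique = trans (unique x x∈V' (λ w → ⇔-id (E x w))) (sym (unique y y∈V' x~y))

  representative : Fin n → InducedV X V'
  representative u with T u
  ... | v , v∈V' , _ = v , v∈V'

  representative-twin : ∀ u → SameNbhd X u (proj₁ (representative u))
  representative-twin u with T u
  ... | _ , _ , u~v , _ = u~v

  -- Replacing both endpoints by their representatives r u, r w does not
  -- change adjacency:  E u w ⇔ E (r u) w ⇔ E w (r u) ⇔ E (r w) (r u) ⇔ E (r u) (r w).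
  representative-full : ∀ u w → E u w ⇔ InducedE X V' (representative u) (representative w)
  representative-full u w =
    flip⇔ ⇔-∘ (representative-twin w (r u) ⇔-∘ (flip⇔ ⇔-∘ representative-twin u w))
    where
    r : Fin n → Fin n
    r = proj₁ ∘ representative
    flip⇔ : ∀ {a b} → E a b ⇔ E b a
    flip⇔ = mk⇔ E-sym E-sym

module _ (R : RealField) (A : List (RealField.Carrier R))
         (positive : All (RealField._<_ R (RealField.0# R)) A)
         {n : ℕ} (X : Graph n) (V' : Subset n) (T : IsTransversal X V') where
  open StrictEmbeddings R A positive
  open Transversal X V' T

  -- Finiteness of Fin n lets the ¬¬ of every single
  -- neighbour comparison be collected into ¬¬ SameNbhd.
  restrict-to-transversal : StrictlyEmbeddable R (Graph.E X) A →
    StrictlyInjectivelyEmbeddable R (InducedE X V') A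
  restrict-to-transversal (φ , strict) =
    φ ∘ proj₁ , pullback-strict proj₁ (λ a b → ⇔-id _) φ strict , injective
    where
    injective : ∀ a b → φ (proj₁ a) ≡ φ (proj₁ b) → a ≡ b
    injective (x , x∈V') (y , y∈V') φx≡φy = inducedV-≡ (decidable-stable (x ≟ y) ¬¬x≡y)
      where
      ¬¬x≡y : ¬ ¬ x ≡ y
      ¬¬x≡y = ¬¬-map (twins-in-V'-coincide x∈V' y∈V')
                (sequence rawApplicative (coincident⇒¬¬sameNbhd strict φx≡φy))

  -- Conversely, placing every vertex at the position of its representative
  -- extends a strict embedding of X' to one of X.
  extend-from-transversal : StrictlyInjectivelyEmbeddable R (InducedE X V') A →
    StrictlyEmbeddable R (Graph.E X) A
  extend-from-transversal (ψ , strict , _) =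
    ψ ∘ representative , pullback-strict representative representative-full ψ strict

proposition2 : (R : RealField) (A : List (RealField.Carrier R)) →
    All (RealField._<_ R (RealField.0# R)) A →
    (n : ℕ) (X : Graph n) (V' : Subset n) → IsTransversal X V' →
    StrictlyEmbeddable R (Graph.E X) A ⇔
      StrictlyInjectivelyEmbeddable R (InducedE X V') A
proposition2 R A positive n X V' T =
  mk⇔ (restrict-to-transversal R A positive X V' T)
      (extend-from-transversal R A positive X V' T)
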